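{- Let $\mathfrak E=(\hat N,\mathcal N,d,\Theta)$ be an EOS satisfying the standing assumptions below, and let $e=(t,\theta)\in\Theta$. If $m$ and $m'$ are configurations of $\mathfrak E$ such that $m\to^e m'$ in $\mathfrak E$, then there is a configuration $k$ of $\mathfrak E^{cons}$ over the trash places such that $m\to^{e^{cons}}m'+k$ in $\mathfrak E^{cons}$.
   Context: EOS: A PN is $(P,T,F)$ with $F:(P\times T)\cup(T\times P)\to\mathbb N$, ${\tt pre}_N(t)(p)=F(p,t)$, ${\tt post}_N(t)(p)=F(t,p)$; $\blacksquare=(\emptyset,\emptyset,\emptyset)$ with unique marking $\varepsilon$. An EOS is $(\hat N,\mathcal N,d,\Theta)$: system PN $\hat N=(\hat P,\hat T,\hat F)$ containing idle transitions $id_p$ ($p\in\hat P$) consuming and producing one token on $p$ only; finite set $\mathcal N\ni\blacksquare$ of object PNs, all nets pairwise disjoint; typing $d:\hat P\to\mathcal N$; finite event set $\Theta$ of pairs $(\hat\tau,\theta)$, $\hat\tau\in\hat T$, $\theta(N)$ a finite multiset of transitions of $N$, with $\theta(d(p))\ne\emptyset$ if $\hat\tau=id_p$. Configurations: finite multisets of nested tokens $(\hat p,m)$, $m$ a marking of $d(\hat p)$. With $\Pi^1(\sum_i(\hat p_i,m_i))=\sum_i\hat p_i$, $\Pi^2_N(\sum_i(\hat p_i,m_i))=\sum_{d(\hat p_i)=N}m_i$: event $(\hat\tau,\theta)$ fires on $\mu$ with mode $(\lambda,\rho)$ iff $\lambda\sqsubseteq\mu$, $\Pi^1(\lambda)={\tt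 pre}_{\hat N}(\hat\tau)$, $\Pi^1(\rho)={\tt post}_{\hat N}(\hat\tau)$, and for all $N$: $\Pi^2_N(\lambda)\ge{\tt pre}_N(\theta(N))$, $\Pi^2_N(\rho)=\Pi^2_N(\lambda)-{\tt pre}_N(\theta(N))+{\tt post}_N(\theta(N))$; result $\mu-\lambda+\rho$. An event is system autonomous if $\theta(N)=\emptyset$ for all $N$. A transition $t\in\hat T$ destroys a type $N\in\mathcal N$ if $\hat F(p,t)\ne0$ for some $p$ with $d(p)=N$ and $\hat F(t,q)=0$ for every $q$ with $d(q)=N$; $\mathit{destroy}(t)$ is the set of types destroyed by $t$. Standing assumptions on $\mathfrak E$: every $t\in\hat T$ occurs in exactly one event of $\Theta$, and if $\mathit{destroy}(t)\ne\emptyset$ then that event is system autonomous. Conservative closure: $\mathfrak E^{cons}=(\hat N^{cons},\mathcal N,d^{cons},\Theta)$ with $\hat N^{cons}=(\hat P\cup\{\mathit{trash}_N: N\in\mathcal N\},\hat T,\hat F^{cons})$ ($\mathit{trash}_N$ new places), $\hat F^{cons}(p,t)=\hat F(p,t)$ (zero for trash places), $\hat F^{cons}(t,p)=\hat F(t,p)$ for $p\in\hat P$, $\hat F^{cons}(t,\mathit{trash}_N)=1$ if $N\in\mathit{destroy}(t)$ and $0$ otherwise; $d^{cons}$ extends $d$ by $d^{cons}(\mathit{trash}_N)=N$. For $e\in\Theta$, $e^{cons}$ denotes the same event regarded in $\mathfrak E^{cons}$. A configuration of $\mathfrak E^{cons}$ is over the trash places if all its nested tokens lie on places $\mathit{trash}_N$.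 -}

module Defs where

open import Data.Nat using (ℕ; zero; suc; _+_; _*_; _∸_; _≤_)
open import Data.Fin using (Fin)
open import Data.Fin.Properties using (any?; all?)
open import Data.Vec using (Vec; lookup; tabulate; zipWith; replicate; sum)
open import Data.List using (List; []; _∷_; _++_; map)
open import Data.List.Membership.Propositional using (_∈_)
open import Data.List.Relation.Unary.All using (All)
open import Data.List.Relation.Binary.Permutation.Propositional using (_↭_)
open import Data.Product using (Σ; ∃; ∃-syntax; _×_; _,_; proj₁; proj₂)
open import Data.Sum using (_⊎_; inj₁; inj₂; [_,_]′)
open import Data.Sum.Properties using (≡-dec)
open import Data.Bool using (Bool; true; false; if_then_else_)
open import Relation.Nullary using (¬_; Dec; yes; no; does)
open import Relation.Binary using (DecidableEquality)
open import Relation.Binary.PropositionalEquality using (_≡_; _≢_; refl; subst)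
import Data.Fin as F

-- The finite set 𝒩 of object nets is indexed by Fin nN;
-- object net N has places Fin (nP N) and transitions Fin (nT N), and its
-- flow function is given by pre/post (pre N t p = F(p,t),
-- post N t p = F(t,p)).  Since each net has its own place/transition
-- types, the nets are automatically pairwise disjoint.

record ObjNets : Set where
  field
    nN   : ℕ
    nP   : Fin nN → ℕ
    nT   : Fin nN → ℕ
    pre  : (N : Fin nN) → Fin (nT N) → Fin (nP N) → ℕ
    post : (N : Fin nN) → Fin (nT N) → Fin (nP N) → ℕ

  Marking : Fin nN → Set
  Marking N = Vec ℕ (nP N)

  TMultiset : Fin nN → Set
  TMultiset N = Fin (nT N) → ℕ

  preM : (N : Fin nN) → TMultiset N → Marking N
  preM N θ = tabulate (λ p → sum (tabulate (λ t → θ t * pre N t p)))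

  postM : (N : Fin nN) → TMultiset N → Marking N
  postM N θ = tabulate (λ p → sum (tabulate (λ t → θ t * post N t p)))

record Sys (O : ObjNets) (Place : Set) : Set where
  open ObjNets O
  field
    nTs  : ℕ
    Fpre  : Place → Fin nTs → ℕ
    Fpost : Fin nTs → Place → ℕ
    d     : Place → Fin nN

record Event (O : ObjNets) (nTs : ℕ) : Set where
  open ObjNets O
  field
    trans : Fin nTs
    θ     : (N : Fin nN) → TMultiset N

SystemAutonomous : ∀ {O nTs} → Event O nTs → Set
SystemAutonomous {O} e = ∀ N t → Event.θ e N t ≡ 0

-- Nested tokens, configurations (finite multisets = lists up to ↭),
-- projections and the firing rule.

module Firing {O : ObjNets} {Place : Set} (_≟P_ : DecidableEquality Place)
              (S : Sys O Place) where
  open ObjNets O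
  open Sys S

  Token : Set
  Token = Σ Place (λ p → Marking (d p))

  Config : Set
  Config = List Token

  countP : Place → List Place → ℕ
  countP p [] = 0
  countP p (q ∷ qs) = (if does (p ≟P q) then 1 else 0) + countP p qs

  Π¹ : Config → List Place
  Π¹ μ = map proj₁ μ

  Π² : (N : Fin nN) → Config → Marking N
  Π² N [] = replicate _ 0
  Π² N ((p , m) ∷ μ) with d p F.≟ N
  ... | yes eq = zipWith _+_ (subst Marking eq m) (Π² N μ)
  ... | no _   = Π² N μ

  -- μ →^e μ' : event e fires on μ with some mode (λ , ρ), giving μ'
  -- (λ ⊑ μ means μ ↭ λ ++ rest, and then μ - λ + ρ is rest ++ ρ).
  record Fires (μ : Config) (e : Event O nTs) (μ' : Config) : Set where
    field
      lam rho rest : Config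
      sub     : μ ↭ lam ++ rest
      result  : μ' ↭ rest ++ rho
      pre¹    : ∀ p → countP p (Π¹ lam) ≡ Fpre p (Event.trans e)
      post¹   : ∀ p → countP p (Π¹ rho) ≡ Fpost (Event.trans e) p
      enabled : ∀ N (q : Fin (nP N)) →
                lookup (preM N (Event.θ e N)) q ≤ lookup (Π² N lam) q
      post²   : ∀ N → Π² N rho ≡
                zipWith _+_ (zipWith _∸_ (Π² N lam) (preM N (Event.θ e N)))
                            (postM N (Event.θ e N))

record EOS : Set₁ where
  field
    O    : ObjNets
    nPs  : ℕ
    S    : Sys O (Fin nPs)
  open ObjNets O public
  open Sys S public
  field
    blank       : Fin nN
    blank-empty : (nP blank ≡ 0) × (nT blank ≡ 0)
    idle        : Fin nPs → Fin nTs
    idle-pre    : ∀ p q → Fpre q (idle p) ≡ (if does (q F.≟ p) then 1 else 0)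
    idle-post   : ∀ p q → Fpost (idle p) q ≡ (if does (q F.≟ p) then 1 else 0)
    Θ           : List (Event O nTs)
    idle-event  : ∀ e → e ∈ Θ → ∀ p → Event.trans e ≡ idle p →
                  ∃[ t ] (Event.θ e (d p) t ≢ 0)

  Destroys : Fin nTs → Fin nN → Set
  Destroys t N = (∃[ p ] (d p ≡ N × Fpre p t ≢ 0))
               × (∀ q → d q ≡ N → Fpost t q ≡ 0)

  destroys? : ∀ t N → Dec (Destroys t N)
  destroys? t N with any? (λ p → dp? p) | all? (λ q → dq? q)
    where
      open import Relation.Nullary using (_×-dec_; _→-dec_; ¬?)
      open import Data.Nat using () renaming (_≟_ to _≟ℕ_)
      dp? : ∀ p → Dec (d p ≡ N × Fpre p t ≢ 0)
      dp? p = (d p F.≟ N) ×-dec ¬? (Fpre p t ≟ℕ 0)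
      dq? : ∀ q → Dec (d q ≡ N → Fpost t q ≡ 0)
      dq? q = (d q F.≟ N) →-dec (Fpost t q ≟ℕ 0)
  ... | yes a | yes b = yes (a , λ q eq → b q eq)
  ... | no ¬a | _     = no (λ x → ¬a (proj₁ x))
  ... | yes _ | no ¬b = no (λ x → ¬b (λ q eq → proj₂ x q eq))

  StandingAssumptions : Set
  StandingAssumptions =
      (∀ t → ∃[ e ] (e ∈ Θ × Event.trans e ≡ t))
    × (∀ e e' → e ∈ Θ → e' ∈ Θ → Event.trans e ≡ Event.trans e' → e ≡ e')
    × (∀ e → e ∈ Θ → (∃[ N ] Destroys (Event.trans e) N) → SystemAutonomous e)

  open Firing F._≟_ S public

  -- Conservative closure: places Fin nPs ⊎ Fin nN (inj₂ N = trash_N).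
  ConsPlace : Set
  ConsPlace = Fin nPs ⊎ Fin nN

  Scons : Sys O ConsPlace
  Scons = record
    { nTs   = nTs
    ; Fpre  = λ p t → [ (λ p' → Fpre p' t) , (λ _ → 0) ]′ p
    ; Fpost = λ t p → [ (λ p' → Fpost t p') ,
                        (λ N → if does (destroys? t N) then 1 else 0) ]′ p
    ; d     = [ d , (λ N → N) ]′
    }

  module Cons = Firing (≡-dec F._≟_ F._≟_) Scons

  embed : Config → Cons.Config
  embed = map (λ x → (inj₁ (proj₁ x) , proj₂ x))

  OverTrash : Cons.Config → Set
  OverTrash k = All (λ x → ∃[ N ] (proj₁ x ≡ inj₂ N)) k

{-# OPTIONS --safe #-}
-- Fire e^cons with the same mode, enlarged on the output side by one nested
-- token with the empty marking on trash_N for every type N destroyed by t.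
-- These are exactly the tokens the system-level postcondition of t demands in
-- E^cons, and being empty they leave every Π²_N, hence all object-level
-- conditions of the mode, unchanged.
module Submission where

open import Defs
open import Data.List using (_++_)
open import Data.List.Membership.Propositional using (_∈_)
open import Data.Product using (∃-syntax; _×_)

open import Data.Product using (_,_; proj₁; proj₂)
open import Function using (_∘_)
open import Data.Nat using (suc; _+_; _∸_; _≤_)
open import Data.Nat.Properties using (+-assoc; +-identityʳ)
open import Data.Fin as F using (Fin)
open import Data.Vec using (lookup; zipWith; replicate)
open import Data.Vec.Properties using (zipWith-assoc; zipWith-identityˡ; zipWith-identityʳ)
open import Data.List using (List; []; _∷_; map; filter; allFin)
open import Data.List.Properties using (map-++; map-∘; ++-assoc)
open import Data.List.Membership.Propositional using (_∉_)
open import Data.List.Membership.Propositional.Properties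
  using (∈-map⁺; ∈-map⁻; ∈-filter⁺; ∈-filter⁻; ∈-allFin)
open import Data.List.Relation.Unary.Any using (here; there)
import Data.List.Relation.Unary.All as All
import Data.List.Relation.Unary.All.Properties as All
open import Data.List.Relation.Unary.Unique.Propositional using (Unique; _∷_)
import Data.List.Relation.Unary.Unique.Propositional.Properties as Unique
open import Data.List.Relation.Binary.Permutation.Propositional
  using (_↭_; ↭-trans; ↭-reflexive)
import Data.List.Relation.Binary.Permutation.Propositional.Properties as ↭
open import Data.Sum using (inj₁; inj₂)
open import Data.Sum.Properties using (inj₂-injective)
open import Data.Bool using (if_then_else_)
open import Relation.Nullary using (does; yes; no; contradiction)
open import Relation.Nullary.Decidable using (dec-true; dec-false)
open import Relation.Binary using (DecidableEquality)
open import Relation.Binary.PropositionalEquality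
  using (_≡_; refl; sym; trans; cong; cong₂; subst; module ≡-Reasoning)

module _ {O : ObjNets} {Place : Set} (_≟P_ : DecidableEquality Place)
         (S : Sys O Place) where
  open Sys S using (d)
  open Firing _≟P_ S

  countP-++ : ∀ p (ps qs : List Place) →
              countP p (ps ++ qs) ≡ countP p ps + countP p qs
  countP-++ p []       qs = refl
  countP-++ p (q ∷ ps) qs =
    trans (cong (_ +_) (countP-++ p ps qs))
          (sym (+-assoc (if does (p ≟P q) then 1 else 0) _ _))

  countP-∉ : ∀ {p} {ps : List Place} → p ∉ ps → countP p ps ≡ 0
  countP-∉ {p} {[]}     p∉ = refl
  countP-∉ {p} {q ∷ ps} p∉ with p ≟P q
  ... | yes p≡q = contradiction (here p≡q) p∉
  ... | no _    = countP-∉ (p∉ ∘ there)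

  countP-unique-∈ : ∀ {p} {ps : List Place} → Unique ps → p ∈ ps → countP p ps ≡ 1
  countP-unique-∈ {p} (p∉ ∷ u) (here refl)
    rewrite dec-true (p ≟P p) refl =
      cong suc (countP-∉ (Unique.Unique[x∷xs]⇒x∉xs (p∉ ∷ u)))
  countP-unique-∈ {p} {q ∷ _} (q≢ ∷ u) (there p∈)
    rewrite dec-false (p ≟P q) (All.lookup q≢ p∈ ∘ sym) = countP-unique-∈ u p∈

  Π²-++ : ∀ N (μ ν : Config) → Π² N (μ ++ ν) ≡ zipWith _+_ (Π² N μ) (Π² N ν)
  Π²-++ N []            ν = sym (zipWith-identityˡ (λ _ → refl) _)
  Π²-++ N ((p , m) ∷ μ) ν with d p F.≟ N
  ... | yes _ = trans (cong (zipWith _+_ _) (Π²-++ N μ ν))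
                      (sym (zipWith-assoc +-assoc _ _ _))
  ... | no _  = Π²-++ N μ ν

module _ (E : EOS) where
  open EOS E

  embedToken : Token → Cons.Token
  embedToken (p , m) = inj₁ p , m

  embed-↭ : ∀ {μ ν} → μ ↭ ν → embed μ ↭ embed ν
  embed-↭ = ↭.map⁺ embedToken

  embed-++ : ∀ μ ν → embed (μ ++ ν) ≡ embed μ ++ embed ν
  embed-++ = map-++ embedToken

  countP-inj₁-embed : ∀ p μ → Cons.countP (inj₁ p) (Cons.Π¹ (embed μ)) ≡ countP p (Π¹ μ)
  countP-inj₁-embed p []            = refl
  countP-inj₁-embed p ((q , _) ∷ μ) with p F.≟ q
  ... | yes _ = cong suc (countP-inj₁-embed p μ)
  ... | no _  = countP-inj₁-embed p μ

  countP-inj₂-embed : ∀ N μ → Cons.countP (inj₂ N) (Cons.Π¹ (embed μ)) ≡ 0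
  countP-inj₂-embed N []      = refl
  countP-inj₂-embed N (_ ∷ μ) = countP-inj₂-embed N μ

  Π²-embed : ∀ N μ → Cons.Π² N (embed μ) ≡ Π² N μ
  Π²-embed N []            = refl
  Π²-embed N ((p , _) ∷ μ) with d p F.≟ N
  ... | yes _ = cong (zipWith _+_ _) (Π²-embed N μ)
  ... | no _  = Π²-embed N μ

  emptyTrashToken : Fin nN → Cons.Token
  emptyTrashToken N = inj₂ N , replicate (nP N) 0

  destroyedTypes : Fin nTs → List (Fin nN)
  destroyedTypes t = filter (destroys? t) (allFin nN)

  trash : Fin nTs → Cons.Config
  trash t = map emptyTrashToken (destroyedTypes t)

  trash-overTrash : ∀ t → OverTrash (trash t)
  trash-overTrash t = All.map⁺ (All.universal (λ N → N , refl) (destroyedTypes t))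

  Π¹-trash : ∀ t → Cons.Π¹ (trash t) ≡ map inj₂ (destroyedTypes t)
  Π¹-trash t = sym (map-∘ (destroyedTypes t))

  countP-inj₁-trash : ∀ p t → Cons.countP (inj₁ p) (Cons.Π¹ (trash t)) ≡ 0
  countP-inj₁-trash p t = go (destroyedTypes t)
    where
    go : ∀ Ns → Cons.countP (inj₁ p) (Cons.Π¹ (map emptyTrashToken Ns)) ≡ 0
    go []       = refl
    go (_ ∷ Ns) = go Ns

  countP-inj₂-trash : ∀ N t → Cons.countP (inj₂ N) (Cons.Π¹ (trash t)) ≡
                               (if does (destroys? t N) then 1 else 0)
  countP-inj₂-trash N t rewrite Π¹-trash t with destroys? t N
  ... | yes t-destroys-N =
    countP-unique-∈ _ Scons
      (Unique.map⁺ inj₂-injective (Unique.filter⁺ (destroys? t) (Unique.allFin⁺ nN)))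
      (∈-map⁺ inj₂ (∈-filter⁺ (destroys? t) (∈-allFin N) t-destroys-N))
  ... | no ¬t-destroys-N = countP-∉ _ Scons N∉
    where
    N∉ : inj₂ N ∉ map inj₂ (destroyedTypes t)
    N∉ N∈ with ∈-map⁻ inj₂ N∈
    ... | _ , N∈′ , refl = ¬t-destroys-N (proj₂ (∈-filter⁻ (destroys? t) {xs = allFin nN} N∈′))

  Π²-trash : ∀ N t → Cons.Π² N (trash t) ≡ replicate (nP N) 0
  Π²-trash N t = go (destroyedTypes t)
    where
    go : ∀ Ns → Cons.Π² N (map emptyTrashToken Ns) ≡ replicate (nP N) 0
    go []       = refl
    go (M ∷ Ns) with M F.≟ N
    ... | yes refl = trans (zipWith-identityˡ (λ _ → refl) _) (go Ns)
    ... | no _     = go Ns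

  fires-cons : ∀ {μ e μ'} → Fires μ e μ' →
               Cons.Fires (embed μ) e (embed μ' ++ trash (Event.trans e))
  fires-cons {e = e} f = record
    { lam     = embed lam
    ; rho     = embed rho ++ K
    ; rest    = embed rest
    ; sub     = ↭-trans (embed-↭ sub) (↭-reflexive (embed-++ lam rest))
    ; result  = ↭-trans (↭.++⁺ʳ K (↭-trans (embed-↭ result) (↭-reflexive (embed-++ rest rho))))
                        (↭-reflexive (++-assoc (embed rest) (embed rho) K))
    ; pre¹    = pre¹-cons
    ; post¹   = post¹-cons
    ; enabled = λ N q → subst (λ v → lookup (preM N (θ N)) q ≤ lookup v q)
                              (sym (Π²-embed N lam)) (enabled N q)
    ; post²   = post²-cons
    }
    where
    open Fires f
    open Event e using (θ) renaming (trans to t)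
    open ≡-Reasoning
    K = trash t

    pre¹-cons : ∀ p → Cons.countP p (Cons.Π¹ (embed lam)) ≡ Sys.Fpre Scons p t
    pre¹-cons (inj₁ p) = trans (countP-inj₁-embed p lam) (pre¹ p)
    pre¹-cons (inj₂ N) = countP-inj₂-embed N lam

    post¹-cons : ∀ p → Cons.countP p (Cons.Π¹ (embed rho ++ K)) ≡ Sys.Fpost Scons t p
    post¹-cons p = begin
      Cons.countP p (Cons.Π¹ (embed rho ++ K))
        ≡⟨ cong (Cons.countP p) (map-++ proj₁ (embed rho) K) ⟩
      Cons.countP p (Cons.Π¹ (embed rho) ++ Cons.Π¹ K)
        ≡⟨ countP-++ _ Scons p (Cons.Π¹ (embed rho)) (Cons.Π¹ K) ⟩
      Cons.countP p (Cons.Π¹ (embed rho)) + Cons.countP p (Cons.Π¹ K)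
        ≡⟨ by-place p ⟩
      Sys.Fpost Scons t p ∎
      where
      by-place : ∀ p → Cons.countP p (Cons.Π¹ (embed rho)) + Cons.countP p (Cons.Π¹ K) ≡
                       Sys.Fpost Scons t p
      by-place (inj₁ q) = begin
        Cons.countP (inj₁ q) (Cons.Π¹ (embed rho)) + Cons.countP (inj₁ q) (Cons.Π¹ K)
          ≡⟨ cong₂ _+_ (countP-inj₁-embed q rho) (countP-inj₁-trash q t) ⟩
        countP q (Π¹ rho) + 0
          ≡⟨ +-identityʳ _ ⟩
        countP q (Π¹ rho)
          ≡⟨ post¹ q ⟩
        Fpost t q ∎
      by-place (inj₂ N) = cong₂ _+_ (countP-inj₂-embed N rho) (countP-inj₂-trash N t)

    post²-cons : ∀ N → Cons.Π² N (embed rho ++ K) ≡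
                 zipWith _+_ (zipWith _∸_ (Cons.Π² N (embed lam)) (preM N (θ N))) (postM N (θ N))
    post²-cons N = begin
      Cons.Π² N (embed rho ++ K)
        ≡⟨ Π²-++ _ Scons N (embed rho) K ⟩
      zipWith _+_ (Cons.Π² N (embed rho)) (Cons.Π² N K)
        ≡⟨ cong₂ (zipWith _+_) (Π²-embed N rho) (Π²-trash N t) ⟩
      zipWith _+_ (Π² N rho) (replicate (nP N) 0)
        ≡⟨ zipWith-identityʳ +-identityʳ _ ⟩
      Π² N rho
        ≡⟨ post² N ⟩
      zipWith _+_ (zipWith _∸_ (Π² N lam) (preM N (θ N))) (postM N (θ N))
        ≡⟨ cong (λ v → zipWith _+_ (zipWith _∸_ v (preM N (θ N))) (postM N (θ N)))
                (sym (Π²-embed N lam)) ⟩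
      zipWith _+_ (zipWith _∸_ (Cons.Π² N (embed lam)) (preM N (θ N))) (postM N (θ N)) ∎

lemma6 : (E : EOS) → EOS.StandingAssumptions E →
    ∀ e → e ∈ EOS.Θ E →
    (m m' : EOS.Config E) → EOS.Fires E m e m' →
    ∃[ k ] (EOS.OverTrash E k ×
    EOS.Cons.Fires E (EOS.embed E m) e (EOS.embed E m' ++ k))
lemma6 E _ e _ _ _ fires = trash E (Event.trans e) , trash-overTrash E _ , fires-cons E fires
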